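{- Let $M$ be a matroid of rank $n$ on $[d]$. For a nonempty subset $e\subseteq[d]$ that is independent in $M$, let $\Delta_e$ be the labeled hypergraph $\Delta_M\cup\{e\}$ in which $e$ is assigned Type $|e|-1$. Then $$\max\{N : N<M\}=\max\Big(\bigcup_{e}\ \max\{N : N\preceq\Delta_e,\ \mathrm{rank}(N)\le n\}\Big),$$ where the union runs over all nonempty $e\subseteq[d]$ independent in $M$, all matroids are on $[d]$, and $\max$ denotes the set of maximal elements in the weak order.
   Context: Weak order: $N\le M$ iff every dependent set of $M$ is dependent in $N$; $N<M$ means $N\le M$, $N\neq M$. Fix $n$. A labeled hypergraph $\Delta$ on $[d]$ is a collection of subsets (edges) each labeled with a Type $i\in\{0,\dots,n-1\}$ ($\Delta_i$ denotes edges of Type $i$). For a matroid $N$ on $[d]$, $N\preceq\Delta$ means $\mathrm{rank}_N(e)\le i$ for all $e\in\Delta_i$ and all $i$. $\Delta_M$ is the labeled hypergraph whose edges of Type $i$ ($0\le i\le n-1$) are the nonempty cyclic flats of $M$ of rank $i$ (a cyclic flat is a flat that is a union of circuits). -}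

module Defs where

open import Data.Nat using (ℕ; _≤_; _<_; _+_; _∸_)
open import Data.Fin using (Fin)
open import Data.Fin.Subset using (Subset; _∈_; _∉_; _⊆_; _⊂_; _∪_; _∩_; ∣_∣; ⁅_⁆; Nonempty; ⊤)
open import Data.Product using (Σ; ∃; ∃-syntax; _×_)
open import Data.Sum using (_⊎_)
open import Relation.Nullary using (¬_)
open import Relation.Binary.PropositionalEquality using (_≡_)

record Matroid (d : ℕ) : Set where
  field
    rk      : Subset d → ℕ
    rk-≤    : ∀ S → rk S ≤ ∣ S ∣
    rk-mono : ∀ S T → S ⊆ T → rk S ≤ rk T
    rk-sub  : ∀ S T → rk (S ∪ T) + rk (S ∩ T) ≤ rk S + rk T
open Matroid public

module _ {d : ℕ} where

  rank : Matroid d → ℕ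
  rank M = rk M ⊤

  Indep : Matroid d → Subset d → Set
  Indep M S = rk M S ≡ ∣ S ∣

  Dependent : Matroid d → Subset d → Set
  Dependent M S = ¬ Indep M S

  _≈M_ : Matroid d → Matroid d → Set
  N ≈M M = ∀ S → rk N S ≡ rk M S

  _≤w_ : Matroid d → Matroid d → Set
  N ≤w M = ∀ S → Dependent M S → Dependent N S

  _<w_ : Matroid d → Matroid d → Set
  N <w M = N ≤w M × ¬ (N ≈M M)

  Circuit : Matroid d → Subset d → Set
  Circuit M C = Dependent M C × (∀ T → T ⊂ C → Indep M T)

  Flat : Matroid d → Subset d → Set
  Flat M F = ∀ x → x ∉ F → rk M F < rk M (F ∪ ⁅ x ⁆)

  Cyclic : Matroid d → Subset d → Set
  Cyclic M F = ∀ x → x ∈ F → ∃[ C ] (Circuit M C × x ∈ C × C ⊆ F)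

  CyclicFlat : Matroid d → Subset d → Set
  CyclicFlat M F = Flat M F × Cyclic M F

  -- labeled hypergraph: Δ S i means S is an edge of Type i
  Hypergraph : Set₁
  Hypergraph = Subset d → ℕ → Set

  ΔM : Matroid d → ℕ → Hypergraph
  ΔM M n S i = CyclicFlat M S × Nonempty S × rk M S ≡ i × i < n

  Δe : Matroid d → ℕ → Subset d → Hypergraph
  Δe M n e S i = ΔM M n S i ⊎ (S ≡ e × i ≡ ∣ e ∣ ∸ 1)

  _⪯_ : Matroid d → Hypergraph → Set
  N ⪯ Δ = ∀ S i → Δ S i → rk N S ≤ i

  IsMax : (Matroid d → Set) → Matroid d → Set
  IsMax P N = P N × (∀ N' → P N' → ¬ (N <w N'))

{-# OPTIONS --safe #-}
-- N <w M holds exactly when rk N ≤ rk M pointwise and some M-independent set e is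
-- N-dependent, i.e. rk N e ≤ ∣ e ∣ ∸ 1. Pointwise domination need only be checked on the
-- nonempty cyclic flats of M of rank < n, given rank N ≤ n: deleting a coloop of M|X lowers
-- rk M X by one and rk N X by at most one, and a coloop-free set lies in a cyclic flat of
-- the same rank (its closure). Hence {N : N <w M} is the union over e of the sets
-- {N : N ⪯ Δe, rank N ≤ n}. Since N <w N′ forces Σ_S rk N S < Σ_S rk N′ S, every member of
-- such a set lies below a maximal one, and so the maximal elements of the union are the
-- maximal ones among the maximal elements of its members.
module Submission where

open import Defs
open import Data.Nat using (ℕ; zero; suc; _≤_; _<_; _+_; _∸_; z≤n; s≤s; s≤s⁻¹; _≤?_; _<?_)
open import Data.Nat.Properties
open import Data.Nat.Induction using (<-wellFounded)
open import Data.Fin using (Fin) renaming (_≟_ to _≟ᶠ_)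
open import Data.Fin.Properties using (any?)
open import Data.Fin.Subset renaming (⊥ to ∅)
open import Data.Fin.Subset.Properties
open import Data.Fin.Subset.Induction using (⊂-wellFounded; ⊃-wellFounded)
open import Data.Vec using ([]; _∷_; here; there)
open import Data.Product using (∃-syntax; _×_; _,_; proj₁)
open import Data.Sum using (inj₁; inj₂; [_,_]′)
open import Function using (_∘_; id; flip)
open import Function.Bundles using (_⇔_; mk⇔)
open import Induction.WellFounded using (WellFounded; Acc; acc; module Subrelation)
import Relation.Binary.Construct.On as On
open import Relation.Binary.PropositionalEquality using (_≡_; refl; sym; trans; subst; cong)
open import Relation.Nullary using (¬_; Dec; yes; no; contradiction)
open import Relation.Nullary.Decidable using (_×-dec_; ¬?; decidable-stable)
open import Relation.Nullary.Negation using (¬¬-map)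

private variable
  n : ℕ
  x : Fin n
  p q : Subset n

x∈p─q⇒x∉q : x ∈ p ─ q → x ∉ q
x∈p─q⇒x∉q {p = inside ∷ _} {outside ∷ _} here        ()
x∈p─q⇒x∉q {p = _ ∷ _}      {_ ∷ _}       (there x∈) (there x∈q) = x∈p─q⇒x∉q x∈ x∈q

x∉p-x : x ∉ p - x
x∉p-x x∈p-x = x∉⁅y⁆⇒x≢y (x∈p─q⇒x∉q x∈p-x) refl

p⊆q∧x∉p⇒p⊆q-x : p ⊆ q → x ∉ p → p ⊆ q - x
p⊆q∧x∉p⇒p⊆q-x p⊆q x∉p y∈p = x∈p∧x≢y⇒x∈p-y (p⊆q y∈p) (λ { refl → x∉p y∈p })

p⊆q∪⁅x⁆∧x∉p⇒p⊆q : p ⊆ q ∪ ⁅ x ⁆ → x ∉ p → p ⊆ q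
p⊆q∪⁅x⁆∧x∉p⇒p⊆q {q = q} {x = x} p⊆q+x x∉p y∈p =
  [ id , (λ y∈⁅x⁆ → contradiction (subst (_∈ _) (x∈⁅y⁆⇒x≡y x y∈⁅x⁆) y∈p) x∉p) ]′
    (x∈p∪q⁻ q ⁅ x ⁆ (p⊆q+x y∈p))

p⊆q-x⇒p∪⁅x⁆⊆q : x ∈ q → p ⊆ q - x → p ∪ ⁅ x ⁆ ⊆ q
p⊆q-x⇒p∪⁅x⁆⊆q {x = x} {p = p} x∈q p⊆q-x y∈ =
  [ p─q⊆p _ _ ∘ p⊆q-x , (λ y∈⁅x⁆ → subst (_∈ _) (sym (x∈⁅y⁆⇒x≡y x y∈⁅x⁆)) x∈q) ]′
    (x∈p∪q⁻ p ⁅ x ⁆ y∈)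

p⊆p-x∪⁅x⁆ : ∀ (p : Subset n) x → p ⊆ (p - x) ∪ ⁅ x ⁆
p⊆p-x∪⁅x⁆ p x {y} y∈p with y ≟ᶠ x
... | yes refl = q⊆p∪q (p - x) ⁅ x ⁆ (x∈⁅x⁆ x)
... | no  y≢x  = p⊆p∪q ⁅ x ⁆ (x∈p∧x≢y⇒x∈p-y y∈p y≢x)

x∉p⇒p⊂p∪⁅x⁆ : x ∉ p → p ⊂ p ∪ ⁅ x ⁆
x∉p⇒p⊂p∪⁅x⁆ {x = x} {p} x∉p = p⊆p∪q ⁅ x ⁆ , x , q⊆p∪q p ⁅ x ⁆ (x∈⁅x⁆ x) , x∉p

∣p∪q∣≤∣p∣+∣q∣ : ∀ (p q : Subset n) → ∣ p ∪ q ∣ ≤ ∣ p ∣ + ∣ q ∣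
∣p∪q∣≤∣p∣+∣q∣ []            []            = z≤n
∣p∪q∣≤∣p∣+∣q∣ (outside ∷ p) (outside ∷ q) = ∣p∪q∣≤∣p∣+∣q∣ p q
∣p∪q∣≤∣p∣+∣q∣ (inside  ∷ p) (outside ∷ q) = s≤s (∣p∪q∣≤∣p∣+∣q∣ p q)
∣p∪q∣≤∣p∣+∣q∣ (outside ∷ p) (inside  ∷ q) =
  ≤-trans (s≤s (∣p∪q∣≤∣p∣+∣q∣ p q)) (≤-reflexive (sym (+-suc ∣ p ∣ ∣ q ∣)))
∣p∪q∣≤∣p∣+∣q∣ (inside  ∷ p) (inside  ∷ q) =
  s≤s (≤-trans (∣p∪q∣≤∣p∣+∣q∣ p q) (+-monoʳ-≤ ∣ p ∣ (n≤1+n ∣ q ∣)))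

∣p∪⁅x⁆∣≤1+∣p∣ : ∀ (p : Subset n) x → ∣ p ∪ ⁅ x ⁆ ∣ ≤ suc ∣ p ∣
∣p∪⁅x⁆∣≤1+∣p∣ p x = begin
  ∣ p ∪ ⁅ x ⁆ ∣       ≤⟨ ∣p∪q∣≤∣p∣+∣q∣ p ⁅ x ⁆ ⟩
  ∣ p ∣ + ∣ ⁅ x ⁆ ∣   ≡⟨ cong (∣ p ∣ +_) (∣⁅x⁆∣≡1 x) ⟩
  ∣ p ∣ + 1           ≡⟨ +-comm ∣ p ∣ 1 ⟩
  suc ∣ p ∣           ∎
  where open ≤-Reasoning

Nonempty⇒∣p∣>0 : Nonempty p → 0 < ∣ p ∣
Nonempty⇒∣p∣>0 (x , x∈p) = ≤-<-trans z≤n (x∈p⇒∣p-x∣<∣p∣ x∈p)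

<⇒≤∸1 : ∀ {m n} → m < n → m ≤ n ∸ 1
<⇒≤∸1 (s≤s m≤n) = m≤n

≤∸1⇒< : ∀ {m n} → 0 < n → m ≤ n ∸ 1 → m < n
≤∸1⇒< (s≤s _) m≤n = s≤s m≤n

module _ {d : ℕ} (M : Matroid d) where

  private variable
    S T X Y I : Subset d

  Indep? : ∀ S → Dec (Indep M S)
  Indep? S = rk M S ≟ ∣ S ∣

  Dependent? : ∀ S → Dec (Dependent M S)
  Dependent? S = ¬? (Indep? S)

  rk-∪-≤ : ∀ S T → rk M (S ∪ T) ≤ rk M S + rk M T
  rk-∪-≤ S T = m+n≤o⇒m≤o (rk M (S ∪ T)) (rk-sub M S T)

  rk≤1+rk[S-x] : ∀ S x → rk M S ≤ suc (rk M (S - x))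
  rk≤1+rk[S-x] S x = begin
    rk M S                       ≤⟨ rk-mono M _ _ (p⊆p-x∪⁅x⁆ S x) ⟩
    rk M ((S - x) ∪ ⁅ x ⁆)       ≤⟨ rk-∪-≤ (S - x) ⁅ x ⁆ ⟩
    rk M (S - x) + rk M ⁅ x ⁆    ≤⟨ +-monoʳ-≤ (rk M (S - x)) (rk-≤ M ⁅ x ⁆) ⟩
    rk M (S - x) + ∣ ⁅ x ⁆ ∣     ≡⟨ cong (rk M (S - x) +_) (∣⁅x⁆∣≡1 x) ⟩
    rk M (S - x) + 1             ≡⟨ +-comm (rk M (S - x)) 1 ⟩
    suc (rk M (S - x))           ∎
    where open ≤-Reasoning

  Empty⇒Indep : Empty S → Indep M S
  Empty⇒Indep S-empty rewrite Empty-unique S-empty =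
    ≤-antisym (rk-≤ M ∅) (≤-trans (≤-reflexive (∣⊥∣≡0 d)) z≤n)

  Dependent⇒Nonempty : Dependent M S → Nonempty S
  Dependent⇒Nonempty {S} depS = decidable-stable (nonempty? S) (depS ∘ Empty⇒Indep)

  Indep-del : Indep M S → x ∈ S → Indep M (S - x)
  Indep-del {S} {x} indS x∈S = ≤-antisym (rk-≤ M (S - x)) (s≤s⁻¹ (begin
    suc ∣ S - x ∣        ≤⟨ x∈p⇒∣p-x∣<∣p∣ x∈S ⟩
    ∣ S ∣                ≡⟨ sym indS ⟩
    rk M S               ≤⟨ rk≤1+rk[S-x] S x ⟩
    suc (rk M (S - x))   ∎))
    where open ≤-Reasoning

  Indep-subset : S ⊆ T → Indep M T → Indep M S
  Indep-subset {S} {T} = go T (⊂-wellFounded T)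
    where
    go : ∀ T → Acc _⊂_ T → S ⊆ T → Indep M T → Indep M S
    go T (acc rec) S⊆T indT with any? (λ x → x ∈? T ×-dec ¬? (x ∈? S))
    ... | yes (x , x∈T , x∉S) =
      go (T - x) (rec (x∈p⇒p-x⊂p x∈T)) (p⊆q∧x∉p⇒p⊆q-x S⊆T x∉S) (Indep-del indT x∈T)
    ... | no ∄x = subst (Indep M) (⊆-antisym T⊆S S⊆T) indT
      where
      T⊆S : T ⊆ S
      T⊆S {x} x∈T = decidable-stable (x ∈? S) (λ x∉S → ∄x (x , x∈T , x∉S))

  Indep-∪⁅x⁆ : I ⊆ X → Indep M I → rk M X < rk M (X ∪ ⁅ x ⁆) → Indep M (I ∪ ⁅ x ⁆)
  Indep-∪⁅x⁆ {I} {X} {x} I⊆X indI rX<rX+x =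
    ≤-antisym (rk-≤ M J) (≤-trans (∣p∪⁅x⁆∣≤1+∣p∣ I x) 1+∣I∣≤rJ)
    where
    J = I ∪ ⁅ x ⁆
    X+x⊆X∪J : X ∪ ⁅ x ⁆ ⊆ X ∪ J
    X+x⊆X∪J y∈ = [ p⊆p∪q J , q⊆p∪q X J ∘ q⊆p∪q I ⁅ x ⁆ ]′ (x∈p∪q⁻ X ⁅ x ⁆ y∈)
    I⊆X∩J : I ⊆ X ∩ J
    I⊆X∩J y∈I = x∈p∩q⁺ (I⊆X y∈I , p⊆p∪q ⁅ x ⁆ y∈I)
    1+∣I∣≤rJ : suc ∣ I ∣ ≤ rk M J
    1+∣I∣≤rJ = +-cancelˡ-≤ (rk M X) _ _ (begin
      rk M X + suc ∣ I ∣             ≡⟨ +-suc (rk M X) ∣ I ∣ ⟩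
      suc (rk M X) + ∣ I ∣           ≤⟨ +-mono-≤ rX<rX+x (≤-reflexive (sym indI)) ⟩
      rk M (X ∪ ⁅ x ⁆) + rk M I      ≤⟨ +-mono-≤ (rk-mono M _ _ X+x⊆X∪J) (rk-mono M _ _ I⊆X∩J) ⟩
      rk M (X ∪ J) + rk M (X ∩ J)    ≤⟨ rk-sub M X J ⟩
      rk M X + rk M J                ∎)
      where open ≤-Reasoning

  ∃-basis : ∀ S → ∃[ I ] (I ⊆ S × Indep M I × rk M S ≤ ∣ I ∣)
  ∃-basis S = go S (⊂-wellFounded S)
    where
    go : ∀ S → Acc _⊂_ S → ∃[ I ] (I ⊆ S × Indep M I × rk M S ≤ ∣ I ∣)
    go S (acc rec) with nonempty? S
    ... | no S-empty = S , id , Empty⇒Indep S-empty , rk-≤ M S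
    ... | yes (y , y∈S) with go (S - y) (rec (x∈p⇒p-x⊂p y∈S)) | rk M S ≤? rk M (S - y)
    ...   | I , I⊆S-y , indI , rS-y≤∣I∣ | yes rS≤rS-y =
      I , p─q⊆p S ⁅ y ⁆ ∘ I⊆S-y , indI , ≤-trans rS≤rS-y rS-y≤∣I∣
    ...   | I , I⊆S-y , indI , rS-y≤∣I∣ | no rS≰rS-y =
      I ∪ ⁅ y ⁆ , p⊆q-x⇒p∪⁅x⁆⊆q y∈S I⊆S-y ,
      Indep-∪⁅x⁆ I⊆S-y indI (<-≤-trans (≰⇒> rS≰rS-y) (rk-mono M _ _ (p⊆p-x∪⁅x⁆ S y))) ,
      (begin
        rk M S              ≤⟨ rk≤1+rk[S-x] S y ⟩
        suc (rk M (S - y))  ≤⟨ s≤s rS-y≤∣I∣ ⟩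
        suc ∣ I ∣           ≤⟨ p⊂q⇒∣p∣<∣q∣ (x∉p⇒p⊂p∪⁅x⁆ (x∉p-x ∘ I⊆S-y)) ⟩
        ∣ I ∪ ⁅ y ⁆ ∣       ∎)
      where open ≤-Reasoning

  Dependent⇒∃-circuit : Dependent M S → ∃[ C ] (Circuit M C × C ⊆ S)
  Dependent⇒∃-circuit {S} = go S (⊂-wellFounded S)
    where
    go : ∀ S → Acc _⊂_ S → Dependent M S → ∃[ C ] (Circuit M C × C ⊆ S)
    go S (acc rec) depS with any? (λ y → y ∈? S ×-dec Dependent? (S - y))
    ... | yes (y , y∈S , depS-y) with go (S - y) (rec (x∈p⇒p-x⊂p y∈S)) depS-y
    ...   | C , circC , C⊆S-y = C , circC , p─q⊆p S ⁅ y ⁆ ∘ C⊆S-y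
    go S (acc rec) depS | no ∄y = S , (depS , minimal) , id
      where
      minimal : ∀ T → T ⊂ S → Indep M T
      minimal T (T⊆S , y , y∈S , y∉T) =
        Indep-subset (p⊆q∧x∉p⇒p⊆q-x T⊆S y∉T)
          (decidable-stable (Indep? (S - y)) (λ depS-y → ∄y (y , y∈S , depS-y)))

  fundamental-circuit : Indep M I → Dependent M (I ∪ ⁅ x ⁆) →
                        ∃[ C ] (Circuit M C × x ∈ C × C ⊆ I ∪ ⁅ x ⁆)
  fundamental-circuit {I} {x} indI depI+x with Dependent⇒∃-circuit depI+x
  ... | C , circC@(depC , _) , C⊆I+x = C , circC , x∈C , C⊆I+x
    where
    x∈C : x ∈ C
    x∈C = decidable-stable (x ∈? C)
      (λ x∉C → depC (Indep-subset (p⊆q∪⁅x⁆∧x∉p⇒p⊆q C⊆I+x x∉C) indI))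

  Dependent-∪⁅x⁆ : x ∉ I → rk M (I ∪ ⁅ x ⁆) ≤ ∣ I ∣ → Dependent M (I ∪ ⁅ x ⁆)
  Dependent-∪⁅x⁆ x∉I rI+x≤∣I∣ indI+x =
    <⇒≱ (p⊂q⇒∣p∣<∣q∣ (x∉p⇒p⊂p∪⁅x⁆ x∉I)) (subst (_≤ _) indI+x rI+x≤∣I∣)

  ∈-circuit : x ∈ Y → rk M Y ≤ rk M (Y - x) → ∃[ C ] (Circuit M C × x ∈ C × C ⊆ Y)
  ∈-circuit {x} {Y} x∈Y rY≤rY-x with ∃-basis (Y - x)
  ... | I , I⊆Y-x , indI , rY-x≤∣I∣ =
    let C , circC , x∈C , C⊆I+x = fundamental-circuit indI (Dependent-∪⁅x⁆ (x∉p-x ∘ I⊆Y-x) rI+x≤∣I∣)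
    in  C , circC , x∈C , ⊆-trans C⊆I+x I+x⊆Y
    where
    I+x⊆Y : I ∪ ⁅ x ⁆ ⊆ Y
    I+x⊆Y = p⊆q-x⇒p∪⁅x⁆⊆q x∈Y I⊆Y-x
    rI+x≤∣I∣ : rk M (I ∪ ⁅ x ⁆) ≤ ∣ I ∣
    rI+x≤∣I∣ = begin
      rk M (I ∪ ⁅ x ⁆)   ≤⟨ rk-mono M _ _ I+x⊆Y ⟩
      rk M Y             ≤⟨ rY≤rY-x ⟩
      rk M (Y - x)       ≤⟨ rY-x≤∣I∣ ⟩
      ∣ I ∣              ∎
      where open ≤-Reasoning

  ColoopFree : Subset d → Set
  ColoopFree X = ∀ {x} → x ∈ X → rk M X ≤ rk M (X - x)

  ColoopFree⇒Cyclic : ColoopFree X → Cyclic M X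
  ColoopFree⇒Cyclic cfX x x∈X = ∈-circuit x∈X (cfX x∈X)

  ColoopFree-∪⁅x⁆ : ColoopFree X → x ∉ X → rk M (X ∪ ⁅ x ⁆) ≤ rk M X →
                    ColoopFree (X ∪ ⁅ x ⁆)
  ColoopFree-∪⁅x⁆ {X} {x} cfX x∉X rX+x≤rX {z} z∈X+x =
    ≤-trans rX+x≤rX ([ z∈X⇒ , z≡x⇒ ∘ x∈⁅y⁆⇒x≡y x ]′ (x∈p∪q⁻ X ⁅ x ⁆ z∈X+x))
    where
    z∈X⇒ : z ∈ X → rk M X ≤ rk M ((X ∪ ⁅ x ⁆) - z)
    z∈X⇒ z∈X = ≤-trans (cfX z∈X)
      (rk-mono M _ _ (p⊆q∧x∉p⇒p⊆q-x (p⊆p∪q ⁅ x ⁆ ∘ p─q⊆p X ⁅ z ⁆) x∉p-x))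
    z≡x⇒ : z ≡ x → rk M X ≤ rk M ((X ∪ ⁅ x ⁆) - z)
    z≡x⇒ refl = rk-mono M _ _ (p⊆q∧x∉p⇒p⊆q-x (p⊆p∪q ⁅ x ⁆) x∉X)

  ColoopFree⇒CyclicFlat-closure : ColoopFree X →
                                  ∃[ F ] (X ⊆ F × CyclicFlat M F × rk M F ≤ rk M X)
  ColoopFree⇒CyclicFlat-closure {X} = go X (⊃-wellFounded X)
    where
    go : ∀ X → Acc _⊃_ X → ColoopFree X → ∃[ F ] (X ⊆ F × CyclicFlat M F × rk M F ≤ rk M X)
    go X (acc rec) cfX with any? (λ x → ¬? (x ∈? X) ×-dec (rk M (X ∪ ⁅ x ⁆) ≤? rk M X))
    ... | no ∄x = X , id , (flat , ColoopFree⇒Cyclic cfX) , ≤-refl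
      where
      flat : Flat M X
      flat x x∉X = ≰⇒> (λ rX+x≤rX → ∄x (x , x∉X , rX+x≤rX))
    ... | yes (x , x∉X , rX+x≤rX)
      with go (X ∪ ⁅ x ⁆) (rec (x∉p⇒p⊂p∪⁅x⁆ x∉X)) (ColoopFree-∪⁅x⁆ cfX x∉X rX+x≤rX)
    ...   | F , X+x⊆F , cfF , rF≤rX+x = F , X+x⊆F ∘ p⊆p∪q ⁅ x ⁆ , cfF , ≤-trans rF≤rX+x rX+x≤rX

Σ-subsets : ∀ n → (Subset n → ℕ) → ℕ
Σ-subsets zero    f = f []
Σ-subsets (suc n) f = Σ-subsets n (f ∘ (inside ∷_)) + Σ-subsets n (f ∘ (outside ∷_))

Σ-subsets-mono-≤ : ∀ n {f g : Subset n → ℕ} → (∀ S → f S ≤ g S) → Σ-subsets n f ≤ Σ-subsets n g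
Σ-subsets-mono-≤ zero    f≤g = f≤g []
Σ-subsets-mono-≤ (suc n) f≤g =
  +-mono-≤ (Σ-subsets-mono-≤ n (f≤g ∘ (inside ∷_))) (Σ-subsets-mono-≤ n (f≤g ∘ (outside ∷_)))

Σ-subsets-mono-< : ∀ n {f g : Subset n → ℕ} → (∀ S → f S ≤ g S) →
                   ∀ S → f S < g S → Σ-subsets n f < Σ-subsets n g
Σ-subsets-mono-< zero    f≤g []            f<g = f<g
Σ-subsets-mono-< (suc n) f≤g (inside ∷ S)  f<g =
  +-mono-<-≤ (Σ-subsets-mono-< n (f≤g ∘ (inside ∷_)) S f<g)
             (Σ-subsets-mono-≤ n (f≤g ∘ (outside ∷_)))
Σ-subsets-mono-< (suc n) f≤g (outside ∷ S) f<g =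
  +-mono-≤-< (Σ-subsets-mono-≤ n (f≤g ∘ (inside ∷_)))
             (Σ-subsets-mono-< n (f≤g ∘ (outside ∷_)) S f<g)

module _ {d : ℕ} where

  ≤w-refl : {M : Matroid d} → M ≤w M
  ≤w-refl S depS = depS

  ≤w-trans : {L M N : Matroid d} → L ≤w M → M ≤w N → L ≤w N
  ≤w-trans L≤M M≤N S depN = L≤M S (M≤N S depN)

  ≤w⇒rk≤ : {N M : Matroid d} → N ≤w M → ∀ S → rk N S ≤ rk M S
  ≤w⇒rk≤ {N} {M} N≤M S with ∃-basis N S
  ... | I , I⊆S , indN , rN≤∣I∣ = begin
    rk N S   ≤⟨ rN≤∣I∣ ⟩
    ∣ I ∣    ≡⟨ sym indM ⟩
    rk M I   ≤⟨ rk-mono M I S I⊆S ⟩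
    rk M S   ∎
    where
    open ≤-Reasoning
    indM : Indep M I
    indM = decidable-stable (Indep? M I) (λ depM → N≤M I depM indN)

  rk≤⇒≤w : {N M : Matroid d} → (∀ S → rk N S ≤ rk M S) → N ≤w M
  rk≤⇒≤w {N} {M} rN≤rM S depM indN =
    depM (≤-antisym (rk-≤ M S) (subst (_≤ rk M S) indN (rN≤rM S)))

  ≤w-antisym : {N M : Matroid d} → N ≤w M → M ≤w N → N ≈M M
  ≤w-antisym {N} {M} N≤M M≤N S = ≤-antisym (≤w⇒rk≤ {N} {M} N≤M S) (≤w⇒rk≤ {M} {N} M≤N S)

  <w-≤w-trans : {L M N : Matroid d} → L <w M → M ≤w N → L <w N
  <w-≤w-trans {L} {M} {N} (L≤M , L≉M) M≤N =
    ≤w-trans {L} {M} {N} L≤M M≤N ,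
    λ L≈N → L≉M (≤w-antisym {L} {M} L≤M (≤w-trans {M} {N} {L} M≤N (N≤L L≈N)))
    where
    N≤L : L ≈M N → N ≤w L
    N≤L L≈N = rk≤⇒≤w {N} {L} (λ S → ≤-reflexive (sym (L≈N S)))

  rk-sum : Matroid d → ℕ
  rk-sum M = Σ-subsets d (rk M)

  rk-sum≤ : (M : Matroid d) → rk-sum M ≤ Σ-subsets d ∣_∣
  rk-sum≤ M = Σ-subsets-mono-≤ d (rk-≤ M)

  <w⇒rk-sum< : {N M : Matroid d} → N <w M → rk-sum N < rk-sum M
  <w⇒rk-sum< {N} {M} (N≤M , N≉M) with anySubset? (λ S → rk N S <? rk M S)
  ... | yes (S , rN<rM) = Σ-subsets-mono-< d (≤w⇒rk≤ {N} {M} N≤M) S rN<rM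
  ... | no ∄S = contradiction N≈M N≉M
    where
    N≈M : N ≈M M
    N≈M S = ≤-antisym (≤w⇒rk≤ {N} {M} N≤M S) (≮⇒≥ (λ rN<rM → ∄S (S , rN<rM)))

  >w-wellFounded : WellFounded (flip (_<w_ {d}))
  >w-wellFounded =
    Subrelation.wellFounded (λ {M} {N} → decreasing {M} {N}) (On.wellFounded slack <-wellFounded)
    where
    slack : Matroid d → ℕ
    slack M = Σ-subsets d ∣_∣ ∸ rk-sum M
    decreasing : {M N : Matroid d} → N <w M → slack M < slack N
    decreasing {M} {N} N<M = ∸-monoʳ-< (<w⇒rk-sum< {N} {M} N<M) (rk-sum≤ M)

  -- Maximality is not decidable for an arbitrary Q, so only the double negation is constructive.
  ¬¬-IsMax-above : (Q : Matroid d → Set) {N : Matroid d} → Q N → ¬ ¬ (∃[ M ] (IsMax Q M × N ≤w M))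
  ¬¬-IsMax-above Q {N} = go N (>w-wellFounded N)
    where
    go : ∀ N → Acc (flip _<w_) N → Q N → ¬ ¬ (∃[ M ] (IsMax Q M × N ≤w M))
    go N (acc rec) qN ∄M = ∄M (N , (qN , N-max) , ≤w-refl {N})
      where
      N-max : ∀ N′ → Q N′ → ¬ (N <w N′)
      N-max N′ qN′ N<N′ = go N′ (rec N<N′) qN′
        (λ (M , maxM , N′≤M) → ∄M (M , maxM , ≤w-trans {N} {N′} {M} (proj₁ N<N′) N′≤M))

  IsMax-cofinal : {P R : Matroid d → Set} →
                  (∀ N → R N → P N) →
                  (∀ N → P N → ¬ ¬ (∃[ M ] (R M × N ≤w M))) →
                  (∀ N → IsMax P N → R N) →
                  ∀ N → IsMax P N ⇔ IsMax R N
  IsMax-cofinal R⇒P cofinal maxP⇒R N = mk⇔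
    (λ maxP@(_ , P-max) → maxP⇒R N maxP , λ N′ rN′ → P-max N′ (R⇒P N′ rN′))
    (λ (rN , R-max) → R⇒P N rN , λ N′ pN′ N<N′ →
       cofinal N′ pN′ (λ (M , rM , N′≤M) → R-max M rM (<w-≤w-trans {N} {N′} {M} N<N′ N′≤M)))

module _ {d : ℕ} (M : Matroid d) (n : ℕ) where

  ⪯ΔM⇒rk≤-CyclicFlat : {L : Matroid d} {F : Subset d} → rank L ≤ n → L ⪯ ΔM M n →
                       CyclicFlat M F → rk L F ≤ rk M F
  ⪯ΔM⇒rk≤-CyclicFlat {L} {F} rankL≤n L⪯ΔM cfF with nonempty? F | rk M F <? n
  ... | no F-empty | _ = ≤-reflexive (trans (Empty⇒Indep L F-empty) (sym (Empty⇒Indep M F-empty)))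
  ... | yes F-ne   | yes rF<n = L⪯ΔM F (rk M F) (cfF , F-ne , refl , rF<n)
  ... | yes _      | no rF≮n = begin
    rk L F   ≤⟨ rk-mono L F ⊤ ⊆⊤ ⟩
    rank L   ≤⟨ rankL≤n ⟩
    n        ≤⟨ ≮⇒≥ rF≮n ⟩
    rk M F   ∎
    where open ≤-Reasoning

  ⪯ΔM⇒rk≤ : {L : Matroid d} → rank L ≤ n → L ⪯ ΔM M n → ∀ X → rk L X ≤ rk M X
  ⪯ΔM⇒rk≤ {L} rankL≤n L⪯ΔM X = go X (⊂-wellFounded X)
    where
    open ≤-Reasoning
    go : ∀ X → Acc _⊂_ X → rk L X ≤ rk M X
    go X (acc rec) with any? (λ x → x ∈? X ×-dec (rk M (X - x) <? rk M X))
    ... | yes (x , x∈X , rX-x<rX) = begin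
      rk L X               ≤⟨ rk≤1+rk[S-x] L X x ⟩
      suc (rk L (X - x))   ≤⟨ s≤s (go (X - x) (rec (x∈p⇒p-x⊂p x∈X))) ⟩
      suc (rk M (X - x))   ≤⟨ rX-x<rX ⟩
      rk M X               ∎
    ... | no ∄x
      with ColoopFree⇒CyclicFlat-closure M (λ x∈X → ≮⇒≥ (λ rX-x<rX → ∄x (_ , x∈X , rX-x<rX)))
    ...   | F , X⊆F , cfF , rF≤rX = begin
      rk L X   ≤⟨ rk-mono L X F X⊆F ⟩
      rk L F   ≤⟨ ⪯ΔM⇒rk≤-CyclicFlat {L} {F} rankL≤n L⪯ΔM cfF ⟩
      rk M F   ≤⟨ rF≤rX ⟩
      rk M X   ∎

  Dependent⇒rk≤∣∣∸1 : {L : Matroid d} {e : Subset d} → Dependent L e → rk L e ≤ ∣ e ∣ ∸ 1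
  Dependent⇒rk≤∣∣∸1 {L} {e} depL = <⇒≤∸1 (≤∧≢⇒< (rk-≤ L e) depL)

  rk≤∣∣∸1⇒Dependent : {L : Matroid d} {e : Subset d} →
                      Nonempty e → rk L e ≤ ∣ e ∣ ∸ 1 → Dependent L e
  rk≤∣∣∸1⇒Dependent e-ne rL≤∣e∣∸1 = <⇒≢ (≤∸1⇒< (Nonempty⇒∣p∣>0 e-ne) rL≤∣e∣∸1)

  Below-Δe : Subset d → Matroid d → Set
  Below-Δe e L = L ⪯ Δe M n e × rank L ≤ n

  Below-some-Δe : Matroid d → Set
  Below-some-Δe L = ∃[ e ] (Nonempty e × Indep M e × Below-Δe e L)

  <w⇒Below-some-Δe : {L : Matroid d} → rank M ≤ n → L <w M → Below-some-Δe L
  <w⇒Below-some-Δe {L} rankM≤n (L≤M , L≉M) with anySubset? (λ S → Indep? M S ×-dec Dependent? L S)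
  ... | no ∄e =
    contradiction (≤w-antisym {N = L} {M = M} L≤M (λ S depL indM → ∄e (S , indM , depL))) L≉M
  ... | yes (e , indM , depL) =
    e , Dependent⇒Nonempty L depL , indM , L⪯Δe , ≤-trans (≤w⇒rk≤ {N = L} {M = M} L≤M ⊤) rankM≤n
    where
    L⪯Δe : L ⪯ Δe M n e
    L⪯Δe S i (inj₁ (_ , _ , refl , _)) = ≤w⇒rk≤ {N = L} {M = M} L≤M S
    L⪯Δe S i (inj₂ (refl , refl))      = Dependent⇒rk≤∣∣∸1 {L} {e} depL

  Below-some-Δe⇒<w : {L : Matroid d} → Below-some-Δe L → L <w M
  Below-some-Δe⇒<w {L} (e , e-ne , indM , L⪯Δe , rankL≤n) =
    rk≤⇒≤w {N = L} {M = M} (⪯ΔM⇒rk≤ {L} rankL≤n (λ S i → L⪯Δe S i ∘ inj₁)) ,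
    λ L≈M → rk≤∣∣∸1⇒Dependent {L} {e} e-ne (L⪯Δe e _ (inj₂ (refl , refl))) (trans (L≈M e) indM)

lemma3p21 : (d n : ℕ) (M : Matroid d) → rank M ≡ n →
    (N : Matroid d) →
    IsMax (λ N′ → N′ <w M) N
      ⇔ IsMax (λ N′ → ∃[ e ] (Nonempty e × Indep M e
                × IsMax (λ L → L ⪯ Δe M n e × rank L ≤ n) N′)) N
lemma3p21 d n M rank≡n = IsMax-cofinal R⇒P P⇒¬¬R maxP⇒R
  where
  R : Matroid d → Set
  R L = ∃[ e ] (Nonempty e × Indep M e × IsMax (Below-Δe M n e) L)

  R⇒P : ∀ L → R L → L <w M
  R⇒P L (e , e-ne , indM , qL , _) = Below-some-Δe⇒<w M n {L} (e , e-ne , indM , qL)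

  P⇒¬¬R : ∀ L → L <w M → ¬ ¬ (∃[ L′ ] (R L′ × L ≤w L′))
  P⇒¬¬R L L<M with <w⇒Below-some-Δe M n {L} (≤-reflexive rank≡n) L<M
  ... | e , e-ne , indM , qL =
    ¬¬-map (λ (L′ , maxL′ , L≤L′) → L′ , (e , e-ne , indM , maxL′) , L≤L′)
           (¬¬-IsMax-above (Below-Δe M n e) {L} qL)

  maxP⇒R : ∀ L → IsMax (_<w M) L → R L
  maxP⇒R L (L<M , P-max) with <w⇒Below-some-Δe M n {L} (≤-reflexive rank≡n) L<M
  ... | e , e-ne , indM , qL =
    e , e-ne , indM , qL , λ L′ qL′ → P-max L′ (Below-some-Δe⇒<w M n {L′} (e , e-ne , indM , qL′))
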